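{- Let $m\ge 1$, $n>1$ and $p\ge 3$ be integers. Then $\theta(mC_p[\bar{K_n}])=0$ if $n$ is even, or $mnp$ is odd, or $n$ is odd and $p\equiv 0\pmod 4$; and $\theta(mC_p[\bar{K_n}])=1$ otherwise.
   Context: $C_p$ is the cycle on $p$ vertices and $\bar{K_n}$ is the edgeless graph on $n$ vertices. For graphs $G,H$, the lexicographic product $G[H]$ has vertex set $V(G)\times V(H)$, with $(g,h)$ adjacent to $(g',h')$ iff $gg'\in E(G)$, or $g=g'$ and $hh'\in E(H)$. $mC_p[\bar{K_n}]$ denotes the disjoint union of $m$ copies of $C_p[\bar{K_n}]$. For a finite set $S$ of positive integers with $|S|=|V(G)|$, a graph $G$ is $S$-magic if there is a bijection $f:V(G)\to S$ and a constant $c$ with $\sum_{v\in N(u)} f(v)=c$ for every vertex $u$, where $N(u)$ is the set of neighbours of $u$. Let $\alpha(S)=\max S$ and $i(G)=\min \alpha(S)$ over all $S$ for which $G$ is $S$-magic; the distance magic index is $\theta(G)=i(G)-|V(G)|$ (and $\theta(G)=\infty$ if no such $S$ exists). -}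

module Defs where

open import Data.Nat using (ℕ; zero; suc; _+_; _*_; _≤_; _≡ᵇ_)
open import Data.Fin using (Fin; toℕ; remQuot; _≟_) renaming (zero to fzero; suc to fsuc)
open import Data.Bool using (Bool; true; false; _∨_; _∧_; if_then_else_)
open import Data.Product using (Σ; ∃; _×_; _,_; proj₁; proj₂)
open import Relation.Nullary.Decidable using (⌊_⌋)
open import Relation.Binary.PropositionalEquality using (_≡_)
open import Function.Definitions using (Injective)

record Graph : Set where
  constructor mkGraph
  field
    N   : ℕ
    adj : Fin N → Fin N → Bool
open Graph public

ΣF : (k : ℕ) → (Fin k → ℕ) → ℕ
ΣF zero    f = 0
ΣF (suc k) f = f fzero + ΣF k (λ i → f (fsuc i))

-- The cycle C_p on vertices 0,…,p-1 (i ~ j iff j = i ± 1 mod p); intended for p ≥ 3.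
cycle : ℕ → Graph
cycle p = mkGraph p (λ i j → succ? i j ∨ succ? j i)
  where
  succ? : Fin p → Fin p → Bool
  succ? i j = (toℕ j ≡ᵇ suc (toℕ i)) ∨ ((toℕ j ≡ᵇ 0) ∧ (suc (toℕ i) ≡ᵇ p))

edgeless : ℕ → Graph
edgeless n = mkGraph n (λ _ _ → false)

-- Lexicographic product G[H]; vertex (g,h) is encoded as combine g h.
lex : Graph → Graph → Graph
lex G H = mkGraph (N G * N H) a
  where
  a : Fin (N G * N H) → Fin (N G * N H) → Bool
  a x y with remQuot {N G} (N H) x | remQuot {N G} (N H) y
  ... | g , h | g' , h' = adj G g g' ∨ (⌊ g ≟ g' ⌋ ∧ adj H h h')

-- Disjoint union of m copies of G; vertex (copy i, vertex v) encoded as combine i v.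
copies : ℕ → Graph → Graph
copies m G = mkGraph (m * N G) a
  where
  a : Fin (m * N G) → Fin (m * N G) → Bool
  a x y with remQuot {m} (N G) x | remQuot {m} (N G) y
  ... | i , v | i' , v' = ⌊ i ≟ i' ⌋ ∧ adj G v v'

mCpKn : ℕ → ℕ → ℕ → Graph
mCpKn m p n = copies m (lex (cycle p) (edgeless n))

nbrSum : (G : Graph) → (Fin (N G) → ℕ) → Fin (N G) → ℕ
nbrSum G f u = ΣF (N G) (λ v → if adj G u v then f v else 0)

-- f is a bijection from V(G) onto a set S of positive integers (S = image of f)
-- with constant neighbourhood sums.  α(S) ≤ M  iff  every label is ≤ M.
IsDistanceMagic : (G : Graph) → (Fin (N G) → ℕ) → Set
IsDistanceMagic G f =
  Injective _≡_ _≡_ f × (∀ v → 1 ≤ f v) × Σ ℕ (λ c → ∀ u → nbrSum G f u ≡ c)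

-- θ(G) = k, i.e. i(G) = min α(S) = |V(G)| + k:
-- some magic labelling attains maximum label |V|+k, and every magic labelling
-- has maximum label ≥ |V|+k.
θ-is : Graph → ℕ → Set
θ-is G k =
  (Σ (Fin (N G) → ℕ) λ f → IsDistanceMagic G f ×
      (∀ v → f v ≤ N G + k) × ∃ (λ v → f v ≡ N G + k))
  × (∀ (f : Fin (N G) → ℕ) → IsDistanceMagic G f → ∃ (λ v → N G + k ≤ f v))

-- Write a vertex of mC_p[K̄_n] as (i, g, h): copy, cycle position, position in the independent set.
-- Its neighbourhood is all of copy i over the two cycle neighbours of g, so a labelling is distance
-- magic exactly when, in every copy, the weights W(i, g) = Σ_h f(i, g, h) of the two cycle neighbours
-- of each g add up to one constant c.
--
-- Injective positive labels give max f ≥ N = mnp. If the labels were exactly 1, …, N,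
-- double counting would force c = n(N + 1), odd when n is odd and N even; but summing the condition
-- over a set A of cycle positions with A(next g) = A(prev g) counts each weight twice, so |A| c is
-- even. For odd p take A = C_p, for p ≡ 2 (mod 4) the odd positions: then |A| is odd.
--
-- Give the mp blocks (i, g) disjoint sets of n labels: complementary pairs x, 2T + 1 − x
-- for even n; for odd n, the three entries of a column of a 3 × mp array of labels, above pairs for
-- the rest. The array has constant column sums when mp is odd, and when mp is even once one label is
-- skipped (θ = 1); without the skip its two classes of columns have sums differing by one, which
-- still works when 4 ∣ p by alternating the classes in the pattern 0 0 1 1 along each cycle.

module Submission where

open import Defs
open import Data.Nat using (ℕ; zero; suc; _+_; _*_; _≤_; _<_; z≤n; s≤s; pred; _≡ᵇ_; _≤?_; _<?_; NonZero; >-nonZero; >-nonZero⁻¹)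
open import Data.Nat.Properties hiding (_≟_)
open import Data.Nat.Properties using () renaming (_≟_ to _≟ℕ_)
open import Data.Nat.Divisibility using (_∣_; divides; _∣?_; _∣0; ∣m+n∣m⇒∣n; ∣1⇒≡1; m∣m*n; ∣m⇒∣m*n; ∣n⇒∣m*n)
open import Data.Nat.Primality using (euclidsLemma; prime[2])
open import Data.Nat.Tactic.RingSolver using (solve-∀)
open import Data.Fin using (Fin; toℕ; _≟_; combine; remQuot; join; splitAt; cast; opposite; punchIn; fromℕ<; fromℕ; inject₁; _↑ˡ_; _↑ʳ_) renaming (zero to fzero; suc to fsuc)
open import Data.Fin.Properties using (toℕ-injective; toℕ<n; toℕ-fromℕ<; toℕ-fromℕ; toℕ-inject₁; toℕ-↑ˡ; toℕ-↑ʳ; toℕ-cast; toℕ-combine; injective⇒≤; any?; punchIn-injective; punchInᵢ≢i; remQuot-combine; combine-remQuot; combine-injective; combine-surjective; splitAt-join; join-splitAt; splitAt-↑ˡ; splitAt-↑ʳ; cast-involutive; opposite-prop; opposite-involutive)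
open import Data.Bool using (Bool; true; false; T; not; _∨_; _∧_; if_then_else_)
open import Data.Bool.Properties using (T-∨; T-∧; ∨-comm; not-involutive)
open import Data.Product using (Σ; ∃; _×_; _,_; proj₁; proj₂)
open import Data.Sum using (_⊎_; inj₁; inj₂; [_,_]′)
open import Data.Sum.Properties using (inj₁-injective; inj₂-injective)
open import Data.Empty using (⊥-elim)
open import Function using (_∘_)
open import Function.Bundles using (_⇔_; mk⇔; Equivalence)
open import Function.Definitions using (Injective)
open import Relation.Nullary using (¬_; yes; no; contradiction)
open import Relation.Nullary.Decidable using (⌊_⌋; decidable-stable)
open import Relation.Binary.PropositionalEquality
open import Algebra.Properties.CommutativeSemigroup +-commutativeSemigroup using (interchange; x∙yz≈y∙xz; xy∙z≈xz∙y)

-- Finite sums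

ΣF-cong : ∀ k {f g : Fin k → ℕ} → (∀ i → f i ≡ g i) → ΣF k f ≡ ΣF k g
ΣF-cong zero    eq = refl
ΣF-cong (suc k) eq = cong₂ _+_ (eq fzero) (ΣF-cong k (λ i → eq (fsuc i)))

ΣF-+ : ∀ k (f g : Fin k → ℕ) → ΣF k (λ i → f i + g i) ≡ ΣF k f + ΣF k g
ΣF-+ zero    f g = refl
ΣF-+ (suc k) f g = trans (cong (f fzero + g fzero +_) (ΣF-+ k (λ i → f (fsuc i)) (λ i → g (fsuc i))))
                         (interchange (f fzero) (g fzero) _ _)

ΣF-const : ∀ k c → ΣF k (λ _ → c) ≡ k * c
ΣF-const zero    c = refl
ΣF-const (suc k) c = cong (c +_) (ΣF-const k c)

ΣF-zero : ∀ k → ΣF k (λ _ → 0) ≡ 0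
ΣF-zero k = trans (ΣF-const k 0) (*-zeroʳ k)

ΣF-*ˡ : ∀ k c (f : Fin k → ℕ) → ΣF k (λ i → c * f i) ≡ c * ΣF k f
ΣF-*ˡ zero    c f = sym (*-zeroʳ c)
ΣF-*ˡ (suc k) c f =
  trans (cong (c * f fzero +_) (ΣF-*ˡ k c (λ i → f (fsuc i)))) (sym (*-distribˡ-+ c (f fzero) _))

ΣF-↑ : ∀ a b (f : Fin (a + b) → ℕ) →
  ΣF (a + b) f ≡ ΣF a (λ i → f (i ↑ˡ b)) + ΣF b (λ j → f (a ↑ʳ j))
ΣF-↑ zero    b f = refl
ΣF-↑ (suc a) b f =
  trans (cong (f fzero +_) (ΣF-↑ a b (λ i → f (fsuc i)))) (sym (+-assoc (f fzero) _ _))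

ΣF-combine : ∀ a b (f : Fin (a * b) → ℕ) →
  ΣF (a * b) f ≡ ΣF a (λ i → ΣF b (λ j → f (combine i j)))
ΣF-combine zero    b f = refl
ΣF-combine (suc a) b f =
  trans (ΣF-↑ b (a * b) f) (cong (ΣF b (λ j → f (j ↑ˡ (a * b))) +_) (ΣF-combine a b (λ x → f (b ↑ʳ x))))

ΣF-swap : ∀ a b (F : Fin a → Fin b → ℕ) →
  ΣF a (λ i → ΣF b (F i)) ≡ ΣF b (λ j → ΣF a (λ i → F i j))
ΣF-swap zero    b F = sym (ΣF-zero b)
ΣF-swap (suc a) b F =
  trans (cong (ΣF b (F fzero) +_) (ΣF-swap a b (λ i → F (fsuc i)))) (sym (ΣF-+ b (F fzero) _))

ΣF-if : ∀ k (c : Bool) (f : Fin k → ℕ) →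
  ΣF k (λ j → if c then f j else 0) ≡ (if c then ΣF k f else 0)
ΣF-if k true  f = refl
ΣF-if k false f = ΣF-zero k

ΣF-indicator : ∀ k (i : Fin k) (f : Fin k → ℕ) → ΣF k (λ j → if ⌊ i ≟ j ⌋ then f j else 0) ≡ f i
ΣF-indicator (suc k) fzero    f = trans (cong (f fzero +_) (ΣF-zero k)) (+-identityʳ _)
ΣF-indicator (suc k) (fsuc i) f =
  trans (ΣF-cong k (λ j → cong (λ b → if b then f (fsuc j) else 0) (≟-suc j)))
        (ΣF-indicator k i (λ j → f (fsuc j)))
  where
  ≟-suc : ∀ j → ⌊ fsuc i ≟ fsuc j ⌋ ≡ ⌊ i ≟ j ⌋
  ≟-suc j with i ≟ j
  ... | yes _ = refl
  ... | no  _ = refl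

ΣF-punchIn : ∀ k (v : Fin (suc k)) (f : Fin (suc k) → ℕ) →
  ΣF (suc k) f ≡ f v + ΣF k (λ j → f (punchIn v j))
ΣF-punchIn k       fzero    f = refl
ΣF-punchIn (suc k) (fsuc v) f =
  trans (cong (f fzero +_) (ΣF-punchIn k v (λ j → f (fsuc j)))) (x∙yz≈y∙xz (f fzero) (f (fsuc v)) _)

ΣF-two-point : ∀ k (c : Fin k → Bool) {a b : Fin k} → a ≢ b → (∀ j → T (c j) ⇔ (j ≡ a ⊎ j ≡ b)) →
  ∀ X → ΣF k (λ j → if c j then X j else 0) ≡ X a + X b
ΣF-two-point k c {a} {b} a≢b c⇔ X =
  trans (ΣF-cong k split) (trans (ΣF-+ k _ _) (cong₂ _+_ (ΣF-indicator k a X) (ΣF-indicator k b X)))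
  where
  split : ∀ j → (if c j then X j else 0) ≡ (if ⌊ a ≟ j ⌋ then X j else 0) + (if ⌊ b ≟ j ⌋ then X j else 0)
  split j with c j | Equivalence.to (c⇔ j) | Equivalence.from (c⇔ j) | a ≟ j | b ≟ j
  ... | _     | _  | _    | yes refl | yes refl = contradiction refl a≢b
  ... | true  | _  | _    | yes refl | no  _    = sym (+-identityʳ (X a))
  ... | true  | _  | _    | no  _    | yes refl = refl
  ... | true  | to | _    | no  j≢a  | no  j≢b  = ⊥-elim ([ j≢a ∘ sym , j≢b ∘ sym ]′ (to _))
  ... | false | _  | from | yes refl | no  _    = ⊥-elim (from (inj₁ refl))
  ... | false | _  | from | no  _    | yes refl = ⊥-elim (from (inj₂ refl))
  ... | false | _  | _    | no  _    | no  _    = refl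

count : ∀ k → (Fin k → Bool) → ℕ
count k A = ΣF k (λ g → if A g then 1 else 0)

ΣF-if-const : ∀ k (A : Fin k → Bool) c → ΣF k (λ g → if A g then c else 0) ≡ count k A * c
ΣF-if-const zero    A c = refl
ΣF-if-const (suc k) A c with A fzero
... | true  = cong (c +_) (ΣF-if-const k (λ g → A (fsuc g)) c)
... | false = ΣF-if-const k (λ g → A (fsuc g)) c

-- Injective labellings

positive-injective⇒≤ : ∀ k M (f : Fin k → ℕ) → Injective _≡_ _≡_ f →
  (∀ v → 1 ≤ f v) → (∀ v → f v ≤ M) → k ≤ M
positive-injective⇒≤ k M f inj pos bnd = injective⇒≤ {f = φ} φ-injective
  where
  below : ∀ v → pred (f v) < M
  below v with f v | pos v | bnd v
  ... | suc x | _ | x<M = x<M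
  φ : Fin k → Fin M
  φ v = fromℕ< (below v)
  φ-injective : Injective _≡_ _≡_ φ
  φ-injective {v} {w} e = inj (pred-injective {{>-nonZero (pos v)}} {{>-nonZero (pos w)}}
    (trans (sym (toℕ-fromℕ< (below v))) (trans (cong toℕ e) (toℕ-fromℕ< (below w)))))

positive-injective⇒∃≥ : ∀ k (f : Fin k → ℕ) → Injective _≡_ _≡_ f → (∀ v → 1 ≤ f v) →
  1 ≤ k → ∃ λ v → k ≤ f v
positive-injective⇒∃≥ k f inj pos 1≤k with any? (λ v → k ≤? f v)
... | yes large = large
... | no  none  = contradiction (positive-injective⇒≤ k (pred k) f inj pos small) (<⇒≱ (pred<k 1≤k))
  where
  small : ∀ v → f v ≤ pred k
  small v = <⇒≤pred (≰⇒> (λ le → none (v , le)))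
  pred<k : ∀ {k} → 1 ≤ k → pred k < k
  pred<k (s≤s _) = ≤-refl

injective⇒2*ΣF≡k*[1+k] : ∀ k (f : Fin k → ℕ) → Injective _≡_ _≡_ f →
  (∀ v → 1 ≤ f v) → (∀ v → f v ≤ k) → 2 * ΣF k f ≡ k * suc k
injective⇒2*ΣF≡k*[1+k] zero    f inj pos bnd = refl
injective⇒2*ΣF≡k*[1+k] (suc k) f inj pos bnd with any? (λ v → f v ≟ℕ suc k)
... | no  none = contradiction (positive-injective⇒≤ (suc k) k f inj pos small) (<-irrefl refl)
  where
  small : ∀ v → f v ≤ k
  small v = <⇒≤pred (≤∧≢⇒< (bnd v) (λ e → none (v , e)))
... | yes (v , fv≡1+k) = begin
  2 * ΣF (suc k) f                                ≡⟨ cong (2 *_) (ΣF-punchIn k v f) ⟩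
  2 * (f v + ΣF k f′)                             ≡⟨ cong (λ x → 2 * (x + ΣF k f′)) fv≡1+k ⟩
  2 * (suc k + ΣF k f′)                           ≡⟨ *-distribˡ-+ 2 (suc k) _ ⟩
  2 * suc k + 2 * ΣF k f′                         ≡⟨ cong (2 * suc k +_) induction ⟩
  2 * suc k + k * suc k                           ≡⟨ *-distribʳ-+ (suc k) 2 k ⟨
  (2 + k) * suc k                                 ≡⟨ *-comm (2 + k) (suc k) ⟩
  suc k * suc (suc k)                             ∎
  where
  open ≡-Reasoning
  f′ : Fin k → ℕ
  f′ j = f (punchIn v j)
  inj′ : Injective _≡_ _≡_ f′
  inj′ e = punchIn-injective v _ _ (inj e)
  bnd′ : ∀ j → f′ j ≤ k
  bnd′ j = <⇒≤pred (≤∧≢⇒< (bnd _) (λ e → punchInᵢ≢i v j (inj (trans e (sym fv≡1+k)))))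
  induction : 2 * ΣF k f′ ≡ k * suc k
  induction = injective⇒2*ΣF≡k*[1+k] k f′ inj′ (λ _ → pos _) bnd′

-- The cycle

Succ : ℕ → ℕ → ℕ → Set
Succ p x y = y ≡ suc x ⊎ (y ≡ 0 × suc x ≡ p)

Succ-functional : ∀ {p x y y′} → y < p → y′ < p → Succ p x y → Succ p x y′ → y ≡ y′
Succ-functional _   _    (inj₁ e)         (inj₁ e′)          = trans e (sym e′)
Succ-functional y<p _    (inj₁ e)         (inj₂ (_ , e₂))    = contradiction (trans e e₂) (<⇒≢ y<p)
Succ-functional _   y′<p (inj₂ (_ , e₂))  (inj₁ e′)          = contradiction (trans e′ e₂) (<⇒≢ y′<p)
Succ-functional _   _    (inj₂ (e₁ , _))  (inj₂ (e₁′ , _))   = trans e₁ (sym e₁′)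

Succ-injective : ∀ {p x x′ y} → Succ p x y → Succ p x′ y → x ≡ x′
Succ-injective (inj₁ e)         (inj₁ e′)         = suc-injective (trans (sym e) e′)
Succ-injective (inj₁ refl)      (inj₂ (() , _))
Succ-injective (inj₂ (refl , _)) (inj₁ ())
Succ-injective (inj₂ (_ , e))   (inj₂ (_ , e′))   = suc-injective (trans e (sym e′))

Succ-asym : ∀ {p x y} → 3 ≤ p → Succ p x y → ¬ Succ p y x
Succ-asym {x = x} _ (inj₁ refl) (inj₁ e)        = contradiction e (<⇒≢ (m<n⇒m<1+n (n<1+n x)))
Succ-asym (s≤s (s≤s ())) (inj₁ refl) (inj₂ (refl , refl))
Succ-asym (s≤s (s≤s ())) (inj₂ (refl , refl)) (inj₁ refl)

next : ∀ {p} → Fin p → Fin p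
next {suc p} g with suc (toℕ g) <? suc p
... | yes lt = fromℕ< lt
... | no  _  = fzero

prev : ∀ {p} → Fin p → Fin p
prev {suc p} fzero    = fromℕ p
prev {suc p} (fsuc g) = inject₁ g

Succ-next : ∀ {p} (g : Fin p) → Succ p (toℕ g) (toℕ (next g))
Succ-next {suc p} g with suc (toℕ g) <? suc p
... | yes lt = inj₁ (toℕ-fromℕ< lt)
... | no  ≮  = inj₂ (refl , ≤-antisym (toℕ<n g) (≮⇒≥ ≮))

Succ-prev : ∀ {p} (g : Fin p) → Succ p (toℕ (prev g)) (toℕ g)
Succ-prev {suc p} fzero    = inj₂ (refl , cong suc (toℕ-fromℕ p))
Succ-prev {suc p} (fsuc g) = inj₁ (cong suc (sym (toℕ-inject₁ g)))

-- The successor test of `cycle` in Defs, so that `adj (cycle p)` unfolds to it.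
succᵇ : ℕ → ℕ → ℕ → Bool
succᵇ p x y = (y ≡ᵇ suc x) ∨ ((y ≡ᵇ 0) ∧ (suc x ≡ᵇ p))

T-succᵇ : ∀ p x y → T (succᵇ p x y) ⇔ Succ p x y
T-succᵇ p x y = mk⇔ to from
  where
  to : T (succᵇ p x y) → Succ p x y
  to t with Equivalence.to T-∨ t
  ... | inj₁ e = inj₁ (≡ᵇ⇒≡ y (suc x) e)
  ... | inj₂ c = let (e₁ , e₂) = Equivalence.to T-∧ c in inj₂ (≡ᵇ⇒≡ y 0 e₁ , ≡ᵇ⇒≡ (suc x) p e₂)
  from : Succ p x y → T (succᵇ p x y)
  from (inj₁ e)         = Equivalence.from T-∨ (inj₁ (≡⇒≡ᵇ y (suc x) e))
  from (inj₂ (e₁ , e₂)) = Equivalence.from T-∨ (inj₂ (Equivalence.from T-∧ (≡⇒≡ᵇ y 0 e₁ , ≡⇒≡ᵇ (suc x) p e₂)))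

adj-cycle-sym : ∀ p (g g′ : Fin p) → adj (cycle p) g g′ ≡ adj (cycle p) g′ g
adj-cycle-sym p g g′ = ∨-comm (succᵇ p (toℕ g) (toℕ g′)) (succᵇ p (toℕ g′) (toℕ g))

T-adj-cycle : ∀ p (g j : Fin p) → T (adj (cycle p) g j) ⇔ (j ≡ next g ⊎ j ≡ prev g)
T-adj-cycle p g j = mk⇔ to from
  where
  to : T (adj (cycle p) g j) → j ≡ next g ⊎ j ≡ prev g
  to t with Equivalence.to (T-∨ {succᵇ p (toℕ g) (toℕ j)}) t
  ... | inj₁ s = inj₁ (toℕ-injective (Succ-functional (toℕ<n j) (toℕ<n (next g))
                         (Equivalence.to (T-succᵇ p _ _) s) (Succ-next g)))
  ... | inj₂ s = inj₂ (toℕ-injective (Succ-injective (Equivalence.to (T-succᵇ p _ _) s) (Succ-prev g)))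
  from : j ≡ next g ⊎ j ≡ prev g → T (adj (cycle p) g j)
  from (inj₁ refl) = Equivalence.from (T-∨ {succᵇ p (toℕ g) (toℕ j)}) (inj₁ (Equivalence.from (T-succᵇ p _ _) (Succ-next g)))
  from (inj₂ refl) = Equivalence.from (T-∨ {succᵇ p (toℕ g) (toℕ j)}) (inj₂ (Equivalence.from (T-succᵇ p _ _) (Succ-prev g)))

next≢prev : ∀ {p} → 3 ≤ p → (g : Fin p) → next g ≢ prev g
next≢prev 3≤p g e = Succ-asym 3≤p (Succ-next g) (subst (λ x → Succ _ (toℕ x) (toℕ g)) (sym e) (Succ-prev g))

ΣF-adj-cycle : ∀ {p} → 3 ≤ p → (g : Fin p) (X : Fin p → ℕ) →
  ΣF p (λ j → if adj (cycle p) g j then X j else 0) ≡ X (next g) + X (prev g)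
ΣF-adj-cycle {p} 3≤p g = ΣF-two-point p (adj (cycle p) g) (next≢prev 3≤p g) (T-adj-cycle p g)

ΣF-class-adj-cycle : ∀ {p} → 3 ≤ p → (A : Fin p → Bool) → (∀ g → A (next g) ≡ A (prev g)) →
  ∀ (X : Fin p → ℕ) →
  ΣF p (λ g → if A g then ΣF p (λ g′ → if adj (cycle p) g g′ then X g′ else 0) else 0)
    ≡ 2 * ΣF p (λ g′ → if A (next g′) then X g′ else 0)
ΣF-class-adj-cycle {p} 3≤p A A-next≡prev X = begin
  ΣF p (λ g → if A g then ΣF p (λ g′ → if adj (cycle p) g g′ then X g′ else 0) else 0)
    ≡⟨ ΣF-cong p (λ g → sym (ΣF-if p (A g) _)) ⟩
  ΣF p (λ g → ΣF p (λ g′ → if A g then (if adj (cycle p) g g′ then X g′ else 0) else 0))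
    ≡⟨ ΣF-swap p p _ ⟩
  ΣF p (λ g′ → ΣF p (λ g → if A g then (if adj (cycle p) g g′ then X g′ else 0) else 0))
    ≡⟨ ΣF-cong p (λ g′ → ΣF-cong p (λ g → if-swap (A g) (adj-cycle-sym p g g′))) ⟩
  ΣF p (λ g′ → ΣF p (λ g → if adj (cycle p) g′ g then (if A g then X g′ else 0) else 0))
    ≡⟨ ΣF-cong p (λ g′ → ΣF-adj-cycle 3≤p g′ (λ g → if A g then X g′ else 0)) ⟩
  ΣF p (λ g′ → (if A (next g′) then X g′ else 0) + (if A (prev g′) then X g′ else 0))
    ≡⟨ ΣF-cong p double ⟩
  ΣF p (λ g′ → 2 * (if A (next g′) then X g′ else 0))
    ≡⟨ ΣF-*ˡ p 2 _ ⟩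
  2 * ΣF p (λ g′ → if A (next g′) then X g′ else 0) ∎
  where
  open ≡-Reasoning
  double : ∀ g′ → (if A (next g′) then X g′ else 0) + (if A (prev g′) then X g′ else 0)
                ≡ 2 * (if A (next g′) then X g′ else 0)
  double g′ rewrite A-next≡prev g′ = cong ((if A (prev g′) then X g′ else 0) +_) (sym (+-identityʳ _))
  if-swap : ∀ {b c : Bool} (a : Bool) {x : ℕ} → b ≡ c →
    (if a then (if b then x else 0) else 0) ≡ (if c then (if a then x else 0) else 0)
  if-swap {true}  true  refl = refl
  if-swap {false} true  refl = refl
  if-swap {true}  false refl = refl
  if-swap {false} false refl = refl

-- Coordinates and neighbourhood sums in mC_p[K̄_n]

module _ {m p n : ℕ} where

  combine₃ : Fin m → Fin p → Fin n → Fin (m * (p * n))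
  combine₃ i g h = combine i (combine g h)

  remQuot₃ : Fin (m * (p * n)) → Fin m × Fin p × Fin n
  remQuot₃ v = let (i , x) = remQuot {m} (p * n) v in i , remQuot {p} n x

  remQuot₃-combine₃ : ∀ i g h → remQuot₃ (combine₃ i g h) ≡ (i , g , h)
  remQuot₃-combine₃ i g h =
    trans (cong (λ (y : Fin m × Fin (p * n)) → proj₁ y , remQuot {p} n (proj₂ y)) (remQuot-combine i (combine g h)))
          (cong (i ,_) (remQuot-combine g h))

  combine₃-remQuot₃ : ∀ v → let (i , g , h) = remQuot₃ v in combine₃ i g h ≡ v
  combine₃-remQuot₃ v =
    trans (cong (combine (proj₁ (remQuot {m} (p * n) v))) (combine-remQuot {p} n (proj₂ (remQuot {m} (p * n) v))))
          (combine-remQuot {m} (p * n) v)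

  remQuot₃-injective : ∀ {v w} → remQuot₃ v ≡ remQuot₃ w → v ≡ w
  remQuot₃-injective {v} {w} e = trans (sym (combine₃-remQuot₃ v)) (trans (cong (λ (c : Fin m × Fin p × Fin n) →
    combine₃ (proj₁ c) (proj₁ (proj₂ c)) (proj₂ (proj₂ c))) e) (combine₃-remQuot₃ w))

  combine₃-elim : (P : Fin (m * (p * n)) → Set) → (∀ i g h → P (combine₃ i g h)) → ∀ v → P v
  combine₃-elim P at v = subst P (combine₃-remQuot₃ v) (at _ _ _)

  fromCoords : (Fin m → Fin p → Fin n → ℕ) → Fin (m * (p * n)) → ℕ
  fromCoords ℓ v = let (i , g , h) = remQuot₃ v in ℓ i g h

  fromCoords-combine₃ : ∀ ℓ i g h → fromCoords ℓ (combine₃ i g h) ≡ ℓ i g h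
  fromCoords-combine₃ ℓ i g h = cong (λ (c : Fin m × Fin p × Fin n) → ℓ (proj₁ c) (proj₁ (proj₂ c)) (proj₂ (proj₂ c)))
                                     (remQuot₃-combine₃ i g h)

  fromCoords-injective : (ℓ : Fin m → Fin p → Fin n → ℕ) →
    (∀ {i g h i′ g′ h′} → ℓ i g h ≡ ℓ i′ g′ h′ → (i , g , h) ≡ (i′ , g′ , h′)) →
    Injective _≡_ _≡_ (fromCoords ℓ)
  fromCoords-injective ℓ inj e = remQuot₃-injective (inj e)

  weight : (Fin (m * (p * n)) → ℕ) → Fin m → Fin p → ℕ
  weight f i g = ΣF n (λ h → f (combine₃ i g h))

  adj-combine₃ : ∀ i g h i′ g′ h′ → adj (mCpKn m p n) (combine₃ i g h) (combine₃ i′ g′ h′)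
             ≡ ⌊ i ≟ i′ ⌋ ∧ (adj (cycle p) g g′ ∨ (⌊ g ≟ g′ ⌋ ∧ false))
  adj-combine₃ i g h i′ g′ h′ =
    trans (cong₂ (λ (x y : Fin m × Fin (p * n)) → ⌊ proj₁ x ≟ proj₁ y ⌋ ∧ adj (lex (cycle p) (edgeless n)) (proj₂ x) (proj₂ y))
                 (remQuot-combine i (combine g h)) (remQuot-combine i′ (combine g′ h′)))
          (cong₂ (λ (x y : Fin p × Fin n) → ⌊ i ≟ i′ ⌋ ∧ (adj (cycle p) (proj₁ x) (proj₁ y) ∨ (⌊ proj₁ x ≟ proj₁ y ⌋ ∧ false)))
                 (remQuot-combine g h) (remQuot-combine g′ h′))

  nbrSum-combine₃ : ∀ f i g h →
    nbrSum (mCpKn m p n) f (combine₃ i g h) ≡ ΣF p (λ g′ → if adj (cycle p) g g′ then weight f i g′ else 0)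
  nbrSum-combine₃ f i g h = begin
    ΣF (m * (p * n)) (λ v → if adj G u v then f v else 0)
      ≡⟨ ΣF-combine m (p * n) _ ⟩
    ΣF m (λ i′ → ΣF (p * n) (λ y → if adj G u (combine i′ y) then f (combine i′ y) else 0))
      ≡⟨ ΣF-cong m (λ i′ → ΣF-combine p n _) ⟩
    ΣF m (λ i′ → ΣF p (λ g′ → ΣF n (λ h′ → if adj G u (combine₃ i′ g′ h′) then f (combine₃ i′ g′ h′) else 0)))
      ≡⟨ ΣF-cong m (λ i′ → ΣF-cong p (λ g′ → ΣF-cong n (λ h′ → nested i′ g′ h′))) ⟩
    ΣF m (λ i′ → ΣF p (λ g′ → ΣF n (λ h′ → if ⌊ i ≟ i′ ⌋ then (if adj (cycle p) g g′ then f (combine₃ i′ g′ h′) else 0) else 0)))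
      ≡⟨ ΣF-cong m (λ i′ → ΣF-cong p (λ g′ → trans (ΣF-if n ⌊ i ≟ i′ ⌋ _)
                       (cong (λ z → if ⌊ i ≟ i′ ⌋ then z else 0) (ΣF-if n (adj (cycle p) g g′) _)))) ⟩
    ΣF m (λ i′ → ΣF p (λ g′ → if ⌊ i ≟ i′ ⌋ then (if adj (cycle p) g g′ then weight f i′ g′ else 0) else 0))
      ≡⟨ ΣF-cong m (λ i′ → ΣF-if p ⌊ i ≟ i′ ⌋ _) ⟩
    ΣF m (λ i′ → if ⌊ i ≟ i′ ⌋ then ΣF p (λ g′ → if adj (cycle p) g g′ then weight f i′ g′ else 0) else 0)
      ≡⟨ ΣF-indicator m i _ ⟩
    ΣF p (λ g′ → if adj (cycle p) g g′ then weight f i g′ else 0) ∎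
    where
    open ≡-Reasoning
    G = mCpKn m p n
    u = combine₃ i g h
    if-∧ : ∀ (a b c : Bool) (x : ℕ) → (if a ∧ (b ∨ (c ∧ false)) then x else 0) ≡ (if a then (if b then x else 0) else 0)
    if-∧ true  true  _     x = refl
    if-∧ true  false true  x = refl
    if-∧ true  false false x = refl
    if-∧ false _     _     x = refl
    nested : ∀ i′ g′ h′ → (if adj G u (combine₃ i′ g′ h′) then f (combine₃ i′ g′ h′) else 0)
           ≡ (if ⌊ i ≟ i′ ⌋ then (if adj (cycle p) g g′ then f (combine₃ i′ g′ h′) else 0) else 0)
    nested i′ g′ h′ = trans (cong (λ b → if b then f (combine₃ i′ g′ h′) else 0) (adj-combine₃ i g h i′ g′ h′))
                            (if-∧ ⌊ i ≟ i′ ⌋ (adj (cycle p) g g′) ⌊ g ≟ g′ ⌋ _)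

  nbrSum-combine₃-cycle : 3 ≤ p → ∀ f i g h →
    nbrSum (mCpKn m p n) f (combine₃ i g h) ≡ weight f i (next g) + weight f i (prev g)
  nbrSum-combine₃-cycle 3≤p f i g h = trans (nbrSum-combine₃ f i g h) (ΣF-adj-cycle 3≤p g (weight f i))

  ΣF-combine₃ : ∀ (F : Fin (m * (p * n)) → ℕ) →
    ΣF (m * (p * n)) F ≡ ΣF m (λ i → ΣF p (λ g → ΣF n (λ h → F (combine₃ i g h))))
  ΣF-combine₃ F = trans (ΣF-combine m (p * n) F) (ΣF-cong m (λ i → ΣF-combine p n _))

  ΣF-nbrSum : 3 ≤ p → ∀ f → ΣF (m * (p * n)) (nbrSum (mCpKn m p n) f) ≡ n * (2 * ΣF (m * (p * n)) f)
  ΣF-nbrSum 3≤p f = begin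
    ΣF (m * (p * n)) (nbrSum (mCpKn m p n) f)
      ≡⟨ ΣF-combine₃ _ ⟩
    ΣF m (λ i → ΣF p (λ g → ΣF n (λ h → nbrSum (mCpKn m p n) f (combine₃ i g h))))
      ≡⟨ ΣF-cong m (λ i → ΣF-cong p (λ g → trans (ΣF-cong n (nbrSum-combine₃ f i g)) (ΣF-const n _))) ⟩
    ΣF m (λ i → ΣF p (λ g → n * ΣF p (λ g′ → if adj (cycle p) g g′ then weight f i g′ else 0)))
      ≡⟨ ΣF-cong m (λ i → ΣF-*ˡ p n _) ⟩
    ΣF m (λ i → n * ΣF p (λ g → ΣF p (λ g′ → if adj (cycle p) g g′ then weight f i g′ else 0)))
      ≡⟨ ΣF-cong m (λ i → cong (n *_) (ΣF-class-adj-cycle 3≤p (λ _ → true) (λ _ → refl) (weight f i))) ⟩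
    ΣF m (λ i → n * (2 * ΣF p (weight f i)))
      ≡⟨ trans (ΣF-*ˡ m n _) (cong (n *_) (ΣF-*ˡ m 2 _)) ⟩
    n * (2 * ΣF m (λ i → ΣF p (weight f i)))
      ≡⟨ cong (λ s → n * (2 * s)) (ΣF-combine₃ f) ⟨
    n * (2 * ΣF (m * (p * n)) f) ∎
    where open ≡-Reasoning

  class-magic-even : 3 ≤ p → ∀ f c → (∀ u → nbrSum (mCpKn m p n) f u ≡ c) →
    (A : Fin p → Bool) → (∀ g → A (next g) ≡ A (prev g)) → Fin m → Fin n → 2 ∣ count p A * c
  class-magic-even 3≤p f c magic A A-next≡prev i h = subst (2 ∣_) (sym double-count) (m∣m*n S)
    where
    open ≡-Reasoning
    S = ΣF p (λ g′ → if A (next g′) then weight f i g′ else 0)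
    double-count : count p A * c ≡ 2 * S
    double-count = begin
      count p A * c
        ≡⟨ ΣF-if-const p A c ⟨
      ΣF p (λ g → if A g then c else 0)
        ≡⟨ ΣF-cong p (λ g → cong (λ x → if A g then x else 0) (trans (sym (magic _)) (nbrSum-combine₃ f i g h))) ⟩
      ΣF p (λ g → if A g then ΣF p (λ g′ → if adj (cycle p) g g′ then weight f i g′ else 0) else 0)
        ≡⟨ ΣF-class-adj-cycle 3≤p A A-next≡prev (weight f i) ⟩
      2 * ΣF p (λ g′ → if A (next g′) then weight f i g′ else 0) ∎

-- Lower bounds

order-nonZero : ∀ {m p n} → 1 ≤ m → 3 ≤ p → 1 ≤ n → NonZero (m * (p * n))
order-nonZero 1≤m 3≤p 1≤n = >-nonZero (*-mono-≤ 1≤m (*-mono-≤ (≤-trans (s≤s z≤n) 3≤p) 1≤n))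

magic-constant : ∀ {m p n} → 1 ≤ m → 3 ≤ p → 1 ≤ n → ∀ f c →
  IsDistanceMagic (mCpKn m p n) f → (∀ u → nbrSum (mCpKn m p n) f u ≡ c) →
  (∀ v → f v ≤ m * (p * n)) → c ≡ n * suc (m * (p * n))
magic-constant {m} {p} {n} 1≤m 3≤p 1≤n f c (inj , pos , _) magic bnd =
  *-cancelˡ-≡ c (n * suc V) V {{order-nonZero 1≤m 3≤p 1≤n}} (begin
    V * c                        ≡⟨ ΣF-const V c ⟨
    ΣF V (λ _ → c)               ≡⟨ ΣF-cong V magic ⟨
    ΣF V (nbrSum (mCpKn m p n) f) ≡⟨ ΣF-nbrSum {m} {p} {n} 3≤p f ⟩
    n * (2 * ΣF V f)             ≡⟨ cong (n *_) (injective⇒2*ΣF≡k*[1+k] V f inj pos bnd) ⟩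
    n * (V * suc V)              ≡⟨ *-assoc n V (suc V) ⟨
    n * V * suc V                ≡⟨ cong (_* suc V) (*-comm n V) ⟩
    V * n * suc V                ≡⟨ *-assoc V n (suc V) ⟩
    V * (n * suc V)              ∎)
  where
  open ≡-Reasoning
  V = m * (p * n)

OddClass : ℕ → Set
OddClass p = Σ (Fin p → Bool) λ A → (∀ g → A (next g) ≡ A (prev g)) × ¬ 2 ∣ count p A

magic-label>order : ∀ {m p n} → 1 ≤ m → 3 ≤ p → ¬ 2 ∣ n → 2 ∣ m * (p * n) → OddClass p →
  ∀ f → IsDistanceMagic (mCpKn m p n) f → ∃ λ v → suc (m * (p * n)) ≤ f v
magic-label>order {n = zero} _ _ 2∤n _ _ _ _ = contradiction (2 ∣0) 2∤n
magic-label>order {suc m} {p} {suc n} 1≤m 3≤p 2∤n 2∣V (A , A-next≡prev , 2∤A) f magic@(_ , _ , c , constant)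
  with any? (λ v → suc (suc m * (p * suc n)) ≤? f v)
... | yes large = large
... | no  none  = ⊥-elim ([ 2∤A , [ 2∤n , 2∤1+V ]′ ∘ euclidsLemma (suc n) (suc V) prime[2] ∘ subst (2 ∣_) c≡ ]′
                    (euclidsLemma (count p A) c prime[2] even))
  where
  V = suc m * (p * suc n)
  c≡ : c ≡ suc n * suc V
  c≡ = magic-constant (s≤s z≤n) 3≤p (s≤s z≤n) f c magic constant
         (λ v → ≤-pred (≰⇒> (λ le → none (v , le))))
  even : 2 ∣ count p A * c
  even = class-magic-even {suc m} {p} {suc n} 3≤p f c constant A A-next≡prev fzero fzero
  2∤1+V : ¬ 2 ∣ suc V
  2∤1+V 2∣1+V = contradiction (∣1⇒≡1 (∣m+n∣m⇒∣n (subst (2 ∣_) (+-comm 1 V) 2∣1+V) 2∣V)) λ ()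

magic-label≥order : ∀ {m p n} → 1 ≤ m → 3 ≤ p → 1 ≤ n →
  ∀ f → IsDistanceMagic (mCpKn m p n) f → ∃ λ v → m * (p * n) + 0 ≤ f v
magic-label≥order {m} {p} {n} 1≤m 3≤p 1≤n f (inj , pos , _)
  with positive-injective⇒∃≥ (m * (p * n)) f inj pos (>-nonZero⁻¹ _ {{order-nonZero 1≤m 3≤p 1≤n}})
... | v , large = v , subst (_≤ f v) (sym (+-identityʳ _)) large

-- An odd class of cycle positions when 4 ∤ p

bit₀ : ℕ → Bool
bit₀ zero    = false
bit₀ (suc x) = not (bit₀ x)

bit₀-2*+ : ∀ y x → bit₀ (2 * y + x) ≡ bit₀ x
bit₀-2*+ zero    x = refl
bit₀-2*+ (suc y) x = begin
  bit₀ (2 * suc y + x)          ≡⟨ cong (λ z → bit₀ (z + x)) (*-suc 2 y) ⟩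
  bit₀ (2 + 2 * y + x)          ≡⟨ cong bit₀ (+-assoc 2 (2 * y) x) ⟩
  not (not (bit₀ (2 * y + x)))  ≡⟨ not-involutive _ ⟩
  bit₀ (2 * y + x)              ≡⟨ bit₀-2*+ y x ⟩
  bit₀ x                        ∎
  where open ≡-Reasoning

bit₀-even : ∀ q → bit₀ (q * 2) ≡ false
bit₀-even q = trans (cong bit₀ (trans (*-comm q 2) (sym (+-identityʳ (2 * q))))) (bit₀-2*+ q 0)

bit₀-Succ : ∀ {q x a b} → Succ (suc q * 2) x a → Succ (suc q * 2) b x → bit₀ a ≡ bit₀ b
bit₀-Succ {b = b} (inj₁ refl)    (inj₁ refl)        = not-involutive (bit₀ b)
bit₀-Succ {q} (inj₁ refl)        (inj₂ (refl , e))  = sym (trans (cong bit₀ (suc-injective e)) (cong not (bit₀-even q)))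
bit₀-Succ {q} (inj₂ (refl , e))  (inj₁ refl)        = sym (trans (cong bit₀ (suc-injective (suc-injective e))) (bit₀-even q))
bit₀-Succ     (inj₂ (refl , ())) (inj₂ (refl , _))

count-bit₀ : ∀ q → count (q * 2) (λ g → bit₀ (toℕ g)) ≡ q
count-bit₀ q = begin
  ΣF (q * 2) (λ g → if bit₀ (toℕ g) then 1 else 0)
    ≡⟨ ΣF-combine q 2 _ ⟩
  ΣF q (λ d → ΣF 2 (λ b → if bit₀ (toℕ (combine d b)) then 1 else 0))
    ≡⟨ ΣF-cong q (λ d → ΣF-cong 2 (λ b → cong (λ x → if bit₀ x then 1 else 0) (toℕ-combine d b))) ⟩
  ΣF q (λ d → ΣF 2 (λ b → if bit₀ (2 * toℕ d + toℕ b) then 1 else 0))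
    ≡⟨ ΣF-cong q (λ d → ΣF-cong 2 (λ b → cong (λ x → if x then 1 else 0) (bit₀-2*+ (toℕ d) (toℕ b)))) ⟩
  ΣF q (λ _ → 1)
    ≡⟨ ΣF-const q 1 ⟩
  q * 1
    ≡⟨ *-identityʳ q ⟩
  q ∎
  where open ≡-Reasoning

oddClass : ∀ {p} → 3 ≤ p → ¬ 4 ∣ p → OddClass p
oddClass {p} 3≤p 4∤p with 2 ∣? p
... | no 2∤p = (λ _ → true) , (λ _ → refl) , subst (λ k → ¬ 2 ∣ k) (sym (trans (ΣF-const p 1) (*-identityʳ p))) 2∤p
... | yes (divides q p≡q*2) with 2 ∣? q
...   | yes (divides r q≡r*2) = contradiction (divides r (trans p≡q*2 (trans (cong (_* 2) q≡r*2) (*-assoc r 2 2)))) 4∤p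
...   | no 2∤q = oddPositions q p≡q*2 2∤q
  where
  oddPositions : ∀ {p} q → p ≡ q * 2 → ¬ 2 ∣ q → OddClass p
  oddPositions zero    refl 2∤0 = contradiction (divides 0 refl) 2∤0
  oddPositions (suc q) refl 2∤q =
    (λ g → bit₀ (toℕ g)) , (λ g → bit₀-Succ {q} (Succ-next g) (Succ-prev g)) ,
    subst (λ k → ¬ 2 ∣ k) (sym (count-bit₀ (suc q))) 2∤q

-- Magic labellings from block labellings

blockSum : ∀ {Blk : Set} n → (Blk → Fin n → ℕ) → Blk → ℕ
blockSum n L b = ΣF n (λ h → suc (L b h))

θ-is-of-blocks : ∀ {m p n} k {Blk : Set} → 3 ≤ p →
  (β : Fin m → Fin p → Blk) → (∀ {i g i′ g′} → β i g ≡ β i′ g′ → i ≡ i′ × g ≡ g′) →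
  (L : Blk → Fin n → ℕ) → (∀ {b h b′ h′} → L b h ≡ L b′ h′ → b ≡ b′ × h ≡ h′) →
  (∀ b h → L b h < m * (p * n) + k) →
  (Σ (Fin m) λ i → Σ (Fin p) λ g → ∃ λ h → suc (L (β i g) h) ≡ m * (p * n) + k) →
  (c : ℕ) → (∀ i g → blockSum n L (β i (next g)) + blockSum n L (β i (prev g)) ≡ c) →
  (∀ f → IsDistanceMagic (mCpKn m p n) f → ∃ λ v → m * (p * n) + k ≤ f v) →
  θ-is (mCpKn m p n) k
θ-is-of-blocks {m} {p} {n} k 3≤p β β-injective L L-injective L< (i , g , h , top) c balanced lower =
  (f , (injective , (λ _ → s≤s z≤n) , c , constant) , (λ v → L< _ _) ,
       combine₃ i g h , trans (fromCoords-combine₃ ℓ i g h) top) ,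
  lower
  where
  ℓ : Fin m → Fin p → Fin n → ℕ
  ℓ i g h = suc (L (β i g) h)
  f = fromCoords ℓ
  ℓ-injective : ∀ {i g h i′ g′ h′} → ℓ i g h ≡ ℓ i′ g′ h′ → (i , g , h) ≡ (i′ , g′ , h′)
  ℓ-injective e with L-injective (suc-injective e)
  ... | βe , refl with β-injective βe
  ...   | refl , refl = refl
  injective = fromCoords-injective ℓ ℓ-injective
  weight≡ : ∀ i g → weight f i g ≡ blockSum n L (β i g)
  weight≡ i g = ΣF-cong n (fromCoords-combine₃ ℓ i g)
  constant : ∀ u → nbrSum (mCpKn m p n) f u ≡ c
  constant = combine₃-elim (λ u → nbrSum (mCpKn m p n) f u ≡ c) λ i g h →
    trans (nbrSum-combine₃-cycle 3≤p f i g h) (trans (cong₂ _+_ (weight≡ i (next g)) (weight≡ i (prev g))) (balanced i g))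

-- Even n: complementary pairs

toℕ+toℕ-opposite : ∀ {n} (x : Fin n) → suc (toℕ x + toℕ (opposite x)) ≡ n
toℕ+toℕ-opposite {n} x = trans (cong (suc (toℕ x) +_) (opposite-prop x)) (m+[n∸m]≡n (toℕ<n x))

opposite-injective : ∀ {n} {x y : Fin n} → opposite x ≡ opposite y → x ≡ y
opposite-injective {x = x} {y} e = trans (sym (opposite-involutive x)) (trans (cong opposite e) (opposite-involutive y))

splitAt-injective : ∀ {a b} {x y : Fin (a + b)} → splitAt a x ≡ splitAt a y → x ≡ y
splitAt-injective {a} {b} {x} {y} e = trans (sym (join-splitAt a b x)) (trans (cong (join a b) e) (join-splitAt a b y))

join-injective : ∀ {a b} {x y : Fin a ⊎ Fin b} → join a b x ≡ join a b y → x ≡ y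
join-injective {a} {b} {x} {y} e = trans (sym (splitAt-join a b x)) (trans (cong (splitAt a) e) (splitAt-join a b y))

module _ {B : ℕ} (t : ℕ) where

  pairUp : Fin B → Fin t ⊎ Fin t → Fin (B * t) ⊎ Fin (B * t)
  pairUp b (inj₁ j) = inj₁ (combine b j)
  pairUp b (inj₂ j) = inj₂ (opposite (combine b j))

  pairUp-injective : ∀ {b x b′ x′} → pairUp b x ≡ pairUp b′ x′ → b ≡ b′ × x ≡ x′
  pairUp-injective {b} {inj₁ j} {b′} {inj₁ j′} e with combine-injective b j b′ j′ (inj₁-injective e)
  ... | refl , refl = refl , refl
  pairUp-injective {b} {inj₂ j} {b′} {inj₂ j′} e with combine-injective b j b′ j′ (opposite-injective (inj₂-injective e))
  ... | refl , refl = refl , refl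

  pairLabel : Fin B → Fin (t + t) → Fin (B * t + B * t)
  pairLabel b h = join (B * t) (B * t) (pairUp b (splitAt t h))

  pairLabel-injective : ∀ {b h b′ h′} → pairLabel b h ≡ pairLabel b′ h′ → b ≡ b′ × h ≡ h′
  pairLabel-injective {b} {h} {b′} {h′} e with pairUp-injective {b} {splitAt t h} {b′} {splitAt t h′} (join-injective e)
  ... | refl , split≡ = refl , splitAt-injective split≡

  pairLabel-sum : ∀ b → blockSum (t + t) (λ b h → toℕ (pairLabel b h)) b ≡ t * suc (B * t + B * t)
  pairLabel-sum b = begin
    ΣF (t + t) (λ h → suc (toℕ (pairLabel b h)))
      ≡⟨ ΣF-↑ t t _ ⟩
    ΣF t (λ j → suc (toℕ (pairLabel b (j ↑ˡ t)))) + ΣF t (λ j → suc (toℕ (pairLabel b (t ↑ʳ j))))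
      ≡⟨ cong₂ _+_ (ΣF-cong t (λ j → cong (λ x → suc (toℕ (join Bt Bt (pairUp b x)))) (splitAt-↑ˡ t j t)))
                   (ΣF-cong t (λ j → cong (λ x → suc (toℕ (join Bt Bt (pairUp b x)))) (splitAt-↑ʳ t t j))) ⟩
    ΣF t (λ j → suc (toℕ (combine b j ↑ˡ Bt))) + ΣF t (λ j → suc (toℕ (Bt ↑ʳ opposite (combine b j))))
      ≡⟨ ΣF-+ t _ _ ⟨
    ΣF t (λ j → suc (toℕ (combine b j ↑ˡ Bt)) + suc (toℕ (Bt ↑ʳ opposite (combine b j))))
      ≡⟨ ΣF-cong t (λ j → complementary (combine b j)) ⟩
    ΣF t (λ _ → suc (Bt + Bt))
      ≡⟨ ΣF-const t _ ⟩
    t * suc (Bt + Bt) ∎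
    where
    open ≡-Reasoning
    Bt = B * t
    complementary : ∀ x → suc (toℕ (x ↑ˡ Bt)) + suc (toℕ (Bt ↑ʳ opposite x)) ≡ suc (Bt + Bt)
    complementary x = begin
      suc (toℕ (x ↑ˡ Bt)) + suc (toℕ (Bt ↑ʳ opposite x))
        ≡⟨ cong₂ (λ a b → suc a + suc b) (toℕ-↑ˡ x Bt) (toℕ-↑ʳ Bt (opposite x)) ⟩
      suc (toℕ x) + suc (Bt + toℕ (opposite x))
        ≡⟨ rearrange (toℕ x) (toℕ (opposite x)) Bt ⟩
      suc (Bt + suc (toℕ x + toℕ (opposite x)))
        ≡⟨ cong (λ y → suc (Bt + y)) (toℕ+toℕ-opposite x) ⟩
      suc (Bt + Bt) ∎
      where
      rearrange : ∀ a b Bt → suc a + suc (Bt + b) ≡ suc (Bt + suc (a + b))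
      rearrange = solve-∀

  pairLabel-top : ∀ b j → toℕ (combine b j) ≡ 0 → suc (toℕ (pairLabel b (t ↑ʳ j))) ≡ B * t + B * t
  pairLabel-top b j x≡0 = begin
    suc (toℕ (pairLabel b (t ↑ʳ j)))       ≡⟨ cong (λ y → suc (toℕ (join Bt Bt (pairUp b y)))) (splitAt-↑ʳ t t j) ⟩
    suc (toℕ (Bt ↑ʳ opposite x))           ≡⟨ cong suc (toℕ-↑ʳ Bt (opposite x)) ⟩
    suc (Bt + toℕ (opposite x))            ≡⟨ +-suc Bt (toℕ (opposite x)) ⟨
    Bt + suc (toℕ (opposite x))            ≡⟨ cong (λ y → Bt + suc (y + toℕ (opposite x))) x≡0 ⟨
    Bt + suc (toℕ x + toℕ (opposite x))    ≡⟨ cong (Bt +_) (toℕ+toℕ-opposite x) ⟩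
    Bt + Bt                                ∎
    where
    open ≡-Reasoning
    Bt = B * t
    x = combine b j

θ-even-n : ∀ {m p t} → 1 ≤ m → 3 ≤ p → 1 ≤ t → θ-is (mCpKn m p (t + t)) 0
θ-even-n {suc m} {p@(suc _)} {suc t} _ 3≤p _ =
  θ-is-of-blocks 0 3≤p combine (λ e → combine-injective _ _ _ _ e)
    L (λ e → pairLabel-injective (suc t) (toℕ-injective e))
    (λ b h → subst (toℕ (pairLabel (suc t) b h) <_) order (toℕ<n (pairLabel (suc t) b h)))
    (fzero , fzero , suc t ↑ʳ fzero , trans (pairLabel-top (suc t) b₀ fzero refl) order)
    _ (λ i g → cong₂ _+_ (pairLabel-sum (suc t) (combine i (next g))) (pairLabel-sum (suc t) (combine i (prev g))))
    (magic-label≥order (s≤s z≤n) 3≤p (s≤s z≤n))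
  where
  B = suc m * p
  L : Fin B → Fin (suc t + suc t) → ℕ
  L b h = toℕ (pairLabel (suc t) b h)
  order : B * suc t + B * suc t ≡ suc m * (p * (suc t + suc t)) + 0
  order = lemma (suc m) p (suc t)
    where
    lemma : ∀ m p t → m * p * t + m * p * t ≡ m * (p * (t + t)) + 0
    lemma = solve-∀
  b₀ : Fin B
  b₀ = combine {suc m} {p} fzero fzero

-- Odd n: columns of a 3 × B array above the pairs

-- Row 0 fills [0, B), row 1 fills [B, 2B + gap) except
-- for B + K₁ when gap = 1, and row 2 runs down through the even (class 0) and odd (class 1) offsets
-- above 2B + gap, so that all columns of a class have the same sum; the two sums differ by
-- (K₀ + gap) − (1 + K₁).
module Triples (K₀ K₁ gap : ℕ) where

  B : ℕ
  B = K₀ + K₁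

  Col : Set
  Col = Fin K₀ ⊎ Fin K₁

  triple : Col → Fin 3 → ℕ
  triple (inj₁ e) fzero               = toℕ e
  triple (inj₂ e) fzero               = K₀ + toℕ e
  triple (inj₁ e) (fsuc fzero)        = B + (K₁ + gap + toℕ e)
  triple (inj₂ e) (fsuc fzero)        = B + toℕ e
  triple (inj₁ e) (fsuc (fsuc fzero)) = B + B + gap + 2 * toℕ (opposite e)
  triple (inj₂ e) (fsuc (fsuc fzero)) = B + B + gap + suc (2 * toℕ (opposite e))

  row₀<B : ∀ c → triple c fzero < B
  row₀<B (inj₁ e) = <-≤-trans (toℕ<n e) (m≤m+n K₀ K₁)
  row₀<B (inj₂ e) = +-monoʳ-< K₀ (toℕ<n e)

  B≤row₁ : ∀ c → B ≤ triple c (fsuc fzero)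
  B≤row₁ (inj₁ e) = m≤m+n B _
  B≤row₁ (inj₂ e) = m≤m+n B _

  row₁<row₂ : ∀ c c′ → triple c (fsuc fzero) < triple c′ (fsuc (fsuc fzero))
  row₁<row₂ c c′ = <-≤-trans (row₁< c) (row₂≥ c′)
    where
    row₁< : ∀ c → triple c (fsuc fzero) < B + B + gap
    row₁< (inj₁ e) = subst (triple (inj₁ e) (fsuc fzero) <_) (sol B K₀ K₁ gap)
                       (+-monoʳ-< B (+-monoʳ-< (K₁ + gap) (toℕ<n e)))
      where
      sol : ∀ B K₀ K₁ gap → B + (K₁ + gap + K₀) ≡ B + (K₀ + K₁) + gap
      sol = solve-∀
    row₁< (inj₂ e) = <-≤-trans (+-monoʳ-< B (<-≤-trans (toℕ<n e) (m≤n+m K₁ K₀))) (m≤m+n (B + B) gap)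
    row₂≥ : ∀ c → B + B + gap ≤ triple c (fsuc (fsuc fzero))
    row₂≥ (inj₁ e) = m≤m+n (B + B + gap) _
    row₂≥ (inj₂ e) = m≤m+n (B + B + gap) _

  row₀<row₂ : ∀ c c′ → triple c fzero < triple c′ (fsuc (fsuc fzero))
  row₀<row₂ c c′ = <-trans (<-≤-trans (row₀<B c) (B≤row₁ c′)) (row₁<row₂ c′ c′)

  row₀-injective : ∀ {c c′} → triple c fzero ≡ triple c′ fzero → c ≡ c′
  row₀-injective {inj₁ e} {inj₁ e′} eq = cong inj₁ (toℕ-injective eq)
  row₀-injective {inj₂ e} {inj₂ e′} eq = cong inj₂ (toℕ-injective (+-cancelˡ-≡ K₀ _ _ eq))
  row₀-injective {inj₁ e} {inj₂ e′} eq = contradiction eq (<⇒≢ (<-≤-trans (toℕ<n e) (m≤m+n K₀ _)))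
  row₀-injective {inj₂ e} {inj₁ e′} eq = contradiction (sym eq) (<⇒≢ (<-≤-trans (toℕ<n e′) (m≤m+n K₀ _)))

  class₁<class₀ : ∀ (e′ : Fin K₁) (e : Fin K₀) → toℕ e′ < K₁ + gap + toℕ e
  class₁<class₀ e′ e = <-≤-trans (toℕ<n e′) (≤-trans (m≤m+n K₁ gap) (m≤m+n (K₁ + gap) (toℕ e)))

  row₁-injective : ∀ {c c′} → triple c (fsuc fzero) ≡ triple c′ (fsuc fzero) → c ≡ c′
  row₁-injective {inj₁ e} {inj₁ e′} eq = cong inj₁ (toℕ-injective (+-cancelˡ-≡ (K₁ + gap) _ _ (+-cancelˡ-≡ B _ _ eq)))
  row₁-injective {inj₂ e} {inj₂ e′} eq = cong inj₂ (toℕ-injective (+-cancelˡ-≡ B _ _ eq))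
  row₁-injective {inj₁ e} {inj₂ e′} eq = contradiction (sym (+-cancelˡ-≡ B _ _ eq)) (<⇒≢ (class₁<class₀ e′ e))
  row₁-injective {inj₂ e} {inj₁ e′} eq = contradiction (+-cancelˡ-≡ B _ _ eq) (<⇒≢ (class₁<class₀ e e′))

  row₂-injective : ∀ {c c′} → triple c (fsuc (fsuc fzero)) ≡ triple c′ (fsuc (fsuc fzero)) → c ≡ c′
  row₂-injective {inj₁ e} {inj₁ e′} eq =
    cong inj₁ (opposite-injective (toℕ-injective (*-cancelˡ-≡ _ _ 2 (+-cancelˡ-≡ (B + B + gap) _ _ eq))))
  row₂-injective {inj₂ e} {inj₂ e′} eq =
    cong inj₂ (opposite-injective (toℕ-injective (*-cancelˡ-≡ _ _ 2 (suc-injective (+-cancelˡ-≡ (B + B + gap) _ _ eq)))))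
  row₂-injective {inj₁ e} {inj₂ e′} eq =
    contradiction (+-cancelˡ-≡ (B + B + gap) _ _ eq) (even≢odd (toℕ (opposite e)) (toℕ (opposite e′)))
  row₂-injective {inj₂ e} {inj₁ e′} eq =
    contradiction (sym (+-cancelˡ-≡ (B + B + gap) _ _ eq)) (even≢odd (toℕ (opposite e′)) (toℕ (opposite e)))

  triple-injective : ∀ {c r c′ r′} → triple c r ≡ triple c′ r′ → c ≡ c′ × r ≡ r′
  triple-injective {c} {fzero} {c′} {fzero} eq = row₀-injective eq , refl
  triple-injective {c} {fsuc fzero} {c′} {fsuc fzero} eq = row₁-injective eq , refl
  triple-injective {c} {fsuc (fsuc fzero)} {c′} {fsuc (fsuc fzero)} eq = row₂-injective eq , refl
  triple-injective {c} {fzero} {c′} {fsuc fzero} eq = contradiction eq (<⇒≢ (<-≤-trans (row₀<B c) (B≤row₁ c′)))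
  triple-injective {c} {fsuc fzero} {c′} {fzero} eq = contradiction (sym eq) (<⇒≢ (<-≤-trans (row₀<B c′) (B≤row₁ c)))
  triple-injective {c} {fzero} {c′} {fsuc (fsuc fzero)} eq = contradiction eq (<⇒≢ (row₀<row₂ c c′))
  triple-injective {c} {fsuc (fsuc fzero)} {c′} {fzero} eq = contradiction (sym eq) (<⇒≢ (row₀<row₂ c′ c))
  triple-injective {c} {fsuc fzero} {c′} {fsuc (fsuc fzero)} eq = contradiction eq (<⇒≢ (row₁<row₂ c c′))
  triple-injective {c} {fsuc (fsuc fzero)} {c′} {fsuc fzero} eq = contradiction (sym eq) (<⇒≢ (row₁<row₂ c′ c))

  colSum : Col → ℕ
  colSum c = ΣF 3 (λ r → suc (triple c r))

  colBase : ℕ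
  colBase = B + B + B + B + suc gap

  colSum-inj₁ : ∀ e → colSum (inj₁ e) ≡ colBase + (K₀ + gap)
  colSum-inj₁ e = trans (sol B K₁ gap (toℕ e) (toℕ (opposite e)))
                        (cong (λ k → B + B + B + (k + K₁) + suc gap + (k + gap)) (toℕ+toℕ-opposite e))
    where
    sol : ∀ B K₁ gap x y → suc x + (suc (B + (K₁ + gap + x)) + (suc (B + B + gap + 2 * y) + 0))
        ≡ B + B + B + (suc (x + y) + K₁) + suc gap + (suc (x + y) + gap)
    sol = solve-∀

  colSum-inj₂ : ∀ e → colSum (inj₂ e) ≡ colBase + suc K₁
  colSum-inj₂ e = trans (sol B K₀ gap (toℕ e) (toℕ (opposite e)))
                        (cong (λ k → B + B + B + (K₀ + k) + suc gap + suc k) (toℕ+toℕ-opposite e))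
    where
    sol : ∀ B K₀ gap x y → suc (K₀ + x) + (suc (B + x) + (suc (B + B + gap + suc (2 * y)) + 0))
        ≡ B + B + B + (K₀ + suc (x + y)) + suc gap + suc (suc (x + y))
    sol = solve-∀

  colSum-balanced : K₀ + gap ≡ suc K₁ → ∀ c c′ → colSum c + colSum c′ ≡ colBase + suc K₁ + (colBase + suc K₁)
  colSum-balanced balance c c′ = cong₂ _+_ (constant c) (constant c′)
    where
    constant : ∀ c → colSum c ≡ colBase + suc K₁
    constant (inj₁ e) = trans (colSum-inj₁ e) (cong (colBase +_) balance)
    constant (inj₂ e) = colSum-inj₂ e

  top-inj₁ : K₀ ≡ suc K₁ → (e : Fin K₀) → toℕ e ≡ 0 → suc (triple (inj₁ e) (fsuc (fsuc fzero))) ≡ B + B + B + gap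
  top-inj₁ K₀≡1+K₁ e e≡0 = begin
    suc (B + B + gap + 2 * o)  ≡⟨ +-suc (B + B + gap) (2 * o) ⟨
    B + B + gap + suc (2 * o)  ≡⟨ cong (B + B + gap +_) odd≡B ⟩
    B + B + gap + B            ≡⟨ xy∙z≈xz∙y (B + B) gap B ⟩
    B + B + B + gap            ∎
    where
    open ≡-Reasoning
    o = toℕ (opposite e)
    o≡K₁ : o ≡ K₁
    o≡K₁ = suc-injective (trans (subst (λ x → suc (x + o) ≡ K₀) e≡0 (toℕ+toℕ-opposite e)) K₀≡1+K₁)
    odd≡B : suc (2 * o) ≡ B
    odd≡B = trans (cong (λ x → suc (x + (x + 0))) o≡K₁)
                  (trans (cong (λ x → suc (K₁ + x)) (+-identityʳ K₁)) (cong (_+ K₁) (sym K₀≡1+K₁)))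

  top-inj₂ : K₀ ≡ K₁ → (e : Fin K₁) → toℕ e ≡ 0 → suc (triple (inj₂ e) (fsuc (fsuc fzero))) ≡ B + B + B + gap
  top-inj₂ K₀≡K₁ e e≡0 = begin
    suc (B + B + gap + suc (2 * o))  ≡⟨ +-suc (B + B + gap) (suc (2 * o)) ⟨
    B + B + gap + suc (suc (2 * o))  ≡⟨ cong (B + B + gap +_) (*-suc 2 o) ⟨
    B + B + gap + 2 * suc o          ≡⟨ cong (λ x → B + B + gap + 2 * x) 1+o≡K₁ ⟩
    B + B + gap + (K₁ + (K₁ + 0))    ≡⟨ cong (λ x → B + B + gap + (x + (K₁ + 0))) K₀≡K₁ ⟨
    B + B + gap + (K₀ + (K₁ + 0))    ≡⟨ cong (λ x → B + B + gap + (K₀ + x)) (+-identityʳ K₁) ⟩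
    B + B + gap + B                  ≡⟨ xy∙z≈xz∙y (B + B) gap B ⟩
    B + B + B + gap                  ∎
    where
    open ≡-Reasoning
    o = toℕ (opposite e)
    1+o≡K₁ : suc o ≡ K₁
    1+o≡K₁ = subst (λ x → suc (x + o) ≡ K₁) e≡0 (toℕ+toℕ-opposite e)

  triple< : K₁ ≤ K₀ → K₀ ≤ suc K₁ → ∀ c r → triple c r < B + B + B + gap
  triple< K₁≤K₀ K₀≤1+K₁ c r =
    ≤-<-trans (≤-row₂ c r) (subst (triple c (fsuc (fsuc fzero)) <_) (xy∙z≈xz∙y (B + B) gap B) (row₂< c))
    where
    open ≤-Reasoning
    row₂< : ∀ c → triple c (fsuc (fsuc fzero)) < B + B + gap + B
    row₂< (inj₁ e) = +-monoʳ-< (B + B + gap) (≤-pred (begin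
      suc (suc (2 * o))  ≡⟨ *-suc 2 o ⟨
      2 * suc o          ≤⟨ *-monoʳ-≤ 2 (toℕ<n (opposite e)) ⟩
      K₀ + (K₀ + 0)      ≤⟨ +-monoʳ-≤ K₀ (≤-trans (≤-reflexive (+-identityʳ K₀)) K₀≤1+K₁) ⟩
      K₀ + suc K₁        ≡⟨ +-suc K₀ K₁ ⟩
      suc B              ∎))
      where o = toℕ (opposite e)
    row₂< (inj₂ e) = +-monoʳ-< (B + B + gap) (begin
      suc (suc (2 * o))  ≡⟨ *-suc 2 o ⟨
      2 * suc o          ≤⟨ *-monoʳ-≤ 2 (toℕ<n (opposite e)) ⟩
      K₁ + (K₁ + 0)      ≤⟨ +-monoˡ-≤ (K₁ + 0) K₁≤K₀ ⟩
      K₀ + (K₁ + 0)      ≡⟨ cong (K₀ +_) (+-identityʳ K₁) ⟩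
      B                  ∎)
      where o = toℕ (opposite e)
    ≤-row₂ : ∀ c r → triple c r ≤ triple c (fsuc (fsuc fzero))
    ≤-row₂ c fzero               = <⇒≤ (row₀<row₂ c c)
    ≤-row₂ c (fsuc fzero)        = <⇒≤ (row₁<row₂ c c)
    ≤-row₂ c (fsuc (fsuc fzero)) = ≤-refl

  module _ (t : ℕ) where

    Z : ℕ
    Z = B * t + B * t

    oddLabel : Col → Fin (3 + (t + t)) → ℕ
    oddLabel c h = [ (λ r → Z + triple c r) , (λ j → toℕ (pairLabel t (join K₀ K₁ c) j)) ]′ (splitAt 3 h)

    pair<triple : ∀ c r (b : Fin B) j → toℕ (pairLabel t b j) < Z + triple c r
    pair<triple c r b j = <-≤-trans (toℕ<n (pairLabel t b j)) (m≤m+n Z _)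

    oddLabel-injective : ∀ {c h c′ h′} → oddLabel c h ≡ oddLabel c′ h′ → c ≡ c′ × h ≡ h′
    oddLabel-injective {c} {h} {c′} {h′} eq
      with splitAt 3 h in split≡ | splitAt 3 h′ in split≡′
    ... | inj₁ r | inj₁ r′ with triple-injective {c} {r} {c′} {r′} (+-cancelˡ-≡ Z _ _ eq)
    ...   | refl , refl = refl , splitAt-injective (trans split≡ (sym split≡′))
    oddLabel-injective {c} {h} {c′} {h′} eq | inj₂ j | inj₂ j′
      with pairLabel-injective t {join K₀ K₁ c} {j} {join K₀ K₁ c′} {j′} (toℕ-injective eq)
    ... | b≡ , refl = join-injective b≡ , splitAt-injective (trans split≡ (sym split≡′))
    oddLabel-injective {c} {h} {c′} {h′} eq | inj₁ r | inj₂ j′ =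
      contradiction (sym eq) (<⇒≢ (pair<triple c r (join K₀ K₁ c′) j′))
    oddLabel-injective {c} {h} {c′} {h′} eq | inj₂ j | inj₁ r′ =
      contradiction eq (<⇒≢ (pair<triple c′ r′ (join K₀ K₁ c) j))

    oddLabel< : K₁ ≤ K₀ → K₀ ≤ suc K₁ → ∀ c h → oddLabel c h < Z + (B + B + B + gap)
    oddLabel< K₁≤K₀ K₀≤1+K₁ c h with splitAt 3 h
    ... | inj₁ r = +-monoʳ-< Z (triple< K₁≤K₀ K₀≤1+K₁ c r)
    ... | inj₂ j = <-trans (pair<triple c fzero (join K₀ K₁ c) j) (+-monoʳ-< Z (triple< K₁≤K₀ K₀≤1+K₁ c fzero))

    blockSum₀ : ℕ
    blockSum₀ = 3 * Z + t * suc Z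

    blockSum-oddLabel : ∀ c → blockSum (3 + (t + t)) oddLabel c ≡ blockSum₀ + colSum c
    blockSum-oddLabel c = begin
      ΣF (3 + (t + t)) (λ h → suc (oddLabel c h))
        ≡⟨ ΣF-↑ 3 (t + t) (λ h → suc (oddLabel c h)) ⟩
      ΣF 3 (λ r → suc (oddLabel c (r ↑ˡ (t + t)))) + ΣF (t + t) (λ j → suc (oddLabel c (3 ↑ʳ j)))
        ≡⟨ cong₂ _+_ (ΣF-cong 3 (λ r → cong (λ x → suc (oddLabel′ x)) (splitAt-↑ˡ 3 r (t + t))))
                     (ΣF-cong (t + t) (λ j → cong (λ x → suc (oddLabel′ x)) (splitAt-↑ʳ 3 (t + t) j))) ⟩
      ΣF 3 (λ r → suc (Z + triple c r)) + blockSum (t + t) (λ b j → toℕ (pairLabel t b j)) (join K₀ K₁ c)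
        ≡⟨ cong₂ _+_ (ΣF-cong 3 (λ r → sym (+-suc Z (triple c r)))) (pairLabel-sum t (join K₀ K₁ c)) ⟩
      ΣF 3 (λ r → Z + suc (triple c r)) + t * suc Z
        ≡⟨ cong (_+ t * suc Z) (trans (ΣF-+ 3 (λ _ → Z) (λ r → suc (triple c r))) (cong (_+ colSum c) (ΣF-const 3 Z))) ⟩
      3 * Z + colSum c + t * suc Z
        ≡⟨ xy∙z≈xz∙y (3 * Z) (colSum c) (t * suc Z) ⟩
      blockSum₀ + colSum c ∎
      where
      open ≡-Reasoning
      oddLabel′ : Fin 3 ⊎ Fin (t + t) → ℕ
      oddLabel′ = [ (λ r → Z + triple c r) , (λ j → toℕ (pairLabel t (join K₀ K₁ c) j)) ]′

  θ-triples : ∀ {m p} t → K₁ ≤ K₀ → K₀ ≤ suc K₁ → 3 ≤ p → m * p ≡ B →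
    (β : Fin m → Fin p → Col) → (∀ {i g i′ g′} → β i g ≡ β i′ g′ → i ≡ i′ × g ≡ g′) →
    (γ : ℕ) → (∀ i g → colSum (β i (next g)) + colSum (β i (prev g)) ≡ γ) →
    (Σ (Fin m) λ i → Σ (Fin p) λ g → suc (triple (β i g) (fsuc (fsuc fzero))) ≡ B + B + B + gap) →
    (∀ f → IsDistanceMagic (mCpKn m p (3 + (t + t))) f → ∃ λ v → m * (p * (3 + (t + t))) + gap ≤ f v) →
    θ-is (mCpKn m p (3 + (t + t))) gap
  θ-triples {m} {p} t K₁≤K₀ K₀≤1+K₁ 3≤p m*p≡B β β-injective γ balanced (i , g , top) lower =
    θ-is-of-blocks gap 3≤p β β-injective (oddLabel t) (oddLabel-injective t)
      (λ c h → subst (oddLabel t c h <_) order (oddLabel< t K₁≤K₀ K₀≤1+K₁ c h))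
      (i , g , fsuc (fsuc fzero) , trans (sym (+-suc (Z t) _)) (trans (cong (Z t +_) top) order))
      _ neighbours

      lower
    where
    neighbours : ∀ i g → blockSum (3 + (t + t)) (oddLabel t) (β i (next g)) + blockSum (3 + (t + t)) (oddLabel t) (β i (prev g))
               ≡ blockSum₀ t + blockSum₀ t + γ
    neighbours i g = begin
      blockSum (3 + (t + t)) (oddLabel t) x + blockSum (3 + (t + t)) (oddLabel t) y
        ≡⟨ cong₂ _+_ (blockSum-oddLabel t x) (blockSum-oddLabel t y) ⟩
      blockSum₀ t + colSum x + (blockSum₀ t + colSum y)
        ≡⟨ interchange (blockSum₀ t) (colSum x) (blockSum₀ t) (colSum y) ⟩
      blockSum₀ t + blockSum₀ t + (colSum x + colSum y)
        ≡⟨ cong (blockSum₀ t + blockSum₀ t +_) (balanced i g) ⟩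
      blockSum₀ t + blockSum₀ t + γ ∎
      where
      open ≡-Reasoning
      x = β i (next g)
      y = β i (prev g)
    order : Z t + (B + B + B + gap) ≡ m * (p * (3 + (t + t))) + gap
    order = begin
      Z t + (B + B + B + gap)           ≡⟨ sol B t gap ⟩
      B * (3 + (t + t)) + gap           ≡⟨ cong (λ x → x * (3 + (t + t)) + gap) m*p≡B ⟨
      m * p * (3 + (t + t)) + gap       ≡⟨ cong (_+ gap) (*-assoc m p _) ⟩
      m * (p * (3 + (t + t))) + gap     ∎
      where
      open ≡-Reasoning
      sol : ∀ B t gap → B * t + B * t + (B + B + B + gap) ≡ B * (3 + (t + t)) + gap
      sol = solve-∀

module _ {m p K₀ K₁ : ℕ} (m*p≡ : m * p ≡ K₀ + K₁) where

  blockOf : Fin m → Fin p → Fin K₀ ⊎ Fin K₁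
  blockOf i g = splitAt K₀ (cast m*p≡ (combine i g))

  blockOf-injective : ∀ {i g i′ g′} → blockOf i g ≡ blockOf i′ g′ → i ≡ i′ × g ≡ g′
  blockOf-injective {i} {g} {i′} {g′} e = combine-injective i g i′ g′ (toℕ-injective (begin
    toℕ (combine i g)                  ≡⟨ toℕ-cast m*p≡ (combine i g) ⟨
    toℕ (cast m*p≡ (combine i g))      ≡⟨ cong toℕ (splitAt-injective e) ⟩
    toℕ (cast m*p≡ (combine i′ g′))    ≡⟨ toℕ-cast m*p≡ (combine i′ g′) ⟩
    toℕ (combine i′ g′)                ∎))
    where open ≡-Reasoning

  blockOf-surjective : ∀ c → Σ (Fin m) λ i → Σ (Fin p) λ g → blockOf i g ≡ c
  blockOf-surjective c with combine-surjective (cast (sym m*p≡) (join K₀ K₁ c))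
  ... | i , g , combine≡ = i , g , (begin
    splitAt K₀ (cast m*p≡ (combine i g))                         ≡⟨ cong (splitAt K₀ ∘ cast m*p≡) combine≡ ⟩
    splitAt K₀ (cast m*p≡ (cast (sym m*p≡) (join K₀ K₁ c)))      ≡⟨ cong (splitAt K₀) (cast-involutive m*p≡ (sym m*p≡) _) ⟩
    splitAt K₀ (join K₀ K₁ c)                                    ≡⟨ splitAt-join K₀ K₁ c ⟩
    c                                                            ∎)
    where open ≡-Reasoning

θ-odd-mp : ∀ {m p H} t → 1 ≤ m → 3 ≤ p → m * p ≡ suc H + H → θ-is (mCpKn m p (3 + (t + t))) 0
θ-odd-mp {m} {p} {H} t 1≤m 3≤p m*p≡ =
  θ-triples {m} {p} t (n≤1+n H) ≤-refl 3≤p m*p≡ (blockOf m*p≡) (blockOf-injective m*p≡) _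
    (λ i g → colSum-balanced balance (blockOf m*p≡ i (next g)) (blockOf m*p≡ i (prev g)))
    (let (i , g , e) = blockOf-surjective m*p≡ (inj₁ fzero) in
     i , g , subst (λ c → suc (triple c (fsuc (fsuc fzero))) ≡ B + B + B + 0) (sym e) (top-inj₁ refl fzero refl))
    (magic-label≥order {m} {p} 1≤m 3≤p (s≤s z≤n))
  where
  open Triples (suc H) H 0
  balance : suc H + 0 ≡ suc H
  balance = +-identityʳ (suc H)

θ-even-mp : ∀ {m p K} t → 1 ≤ m → 3 ≤ p → m * p ≡ suc K + suc K →
  OddClass p → θ-is (mCpKn m p (3 + (t + t))) 1
θ-even-mp {m} {p} {K} t 1≤m 3≤p m*p≡ odd =
  θ-triples {m} {p} t ≤-refl (n≤1+n (suc K)) 3≤p m*p≡ (blockOf m*p≡) (blockOf-injective m*p≡) _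
    (λ i g → colSum-balanced balance (blockOf m*p≡ i (next g)) (blockOf m*p≡ i (prev g)))
    (let (i , g , e) = blockOf-surjective m*p≡ (inj₂ fzero) in
     i , g , subst (λ c → suc (triple c (fsuc (fsuc fzero))) ≡ B + B + B + 1) (sym e) (top-inj₂ refl fzero refl))
    (λ f magic → let (v , large) = magic-label>order {m} {p} 1≤m 3≤p 2∤n 2∣order odd f magic in
                 v , subst (_≤ f v) (+-comm 1 _) large)
  where
  open Triples (suc K) (suc K) 1
  balance : suc K + 1 ≡ suc (suc K)
  balance = +-comm (suc K) 1
  2∤n : ¬ 2 ∣ 3 + (t + t)
  2∤n (divides q e) = even≢odd q (suc t) (trans (*-comm 2 q) (trans (sym e) (sol t)))
    where
    sol : ∀ t → 3 + (t + t) ≡ suc (2 * suc t)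
    sol = solve-∀
  2∣order : 2 ∣ m * (p * (3 + (t + t)))
  2∣order = divides (suc K * (3 + (t + t))) (begin
    m * (p * (3 + (t + t)))          ≡⟨ *-assoc m p _ ⟨
    m * p * (3 + (t + t))            ≡⟨ cong (_* (3 + (t + t))) m*p≡ ⟩
    (suc K + suc K) * (3 + (t + t))  ≡⟨ sol (suc K) (3 + (t + t)) ⟩
    suc K * (3 + (t + t)) * 2        ∎)
    where
    open ≡-Reasoning
    sol : ∀ k n → (k + k) * n ≡ k * n * 2
    sol = solve-∀

-- 4 ∣ p: the class of position g is its second binary digit, so the two cycle neighbours of g,
-- which differ by 2 modulo 4, lie in different classes.

bit₁ : ℕ → Bool
bit₁ zero                = false
bit₁ (suc zero)          = false
bit₁ (suc (suc x))       = not (bit₁ x)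

bit₁-4*+ : ∀ y x → bit₁ (4 * y + x) ≡ bit₁ x
bit₁-4*+ zero    x = refl
bit₁-4*+ (suc y) x = begin
  bit₁ (4 * suc y + x)    ≡⟨ cong (λ z → bit₁ (z + x)) (*-suc 4 y) ⟩
  bit₁ (4 + 4 * y + x)    ≡⟨ cong bit₁ (+-assoc 4 (4 * y) x) ⟩
  not (not (bit₁ (4 * y + x))) ≡⟨ not-involutive _ ⟩
  bit₁ (4 * y + x)        ≡⟨ bit₁-4*+ y x ⟩
  bit₁ x                  ∎
  where open ≡-Reasoning

bit₁-Succ : ∀ {q x a b} → Succ (suc q * 4) x a → Succ (suc q * 4) b x → bit₁ a ≡ not (bit₁ b)
bit₁-Succ         (inj₁ refl)       (inj₁ refl)       = refl
bit₁-Succ {q}     (inj₁ refl)       (inj₂ (refl , e)) = cong not (sym (trans (cong bit₁ (last≡ e)) (bit₁-4*+ q 3)))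
  where
  last≡ : ∀ {b} → suc b ≡ suc q * 4 → b ≡ 4 * q + 3
  last≡ e = trans (suc-injective e) (trans (+-comm 3 (q * 4)) (cong (_+ 3) (*-comm q 4)))
bit₁-Succ {q} {b = b} (inj₂ (refl , e)) (inj₁ refl)   = cong not (sym (trans (cong bit₁ (penultimate≡ e)) (bit₁-4*+ q 2)))
  where
  penultimate≡ : suc (suc b) ≡ suc q * 4 → b ≡ 4 * q + 2
  penultimate≡ e = trans (suc-injective (suc-injective e)) (trans (+-comm 2 (q * 4)) (cong (_+ 2) (*-comm q 4)))
bit₁-Succ (inj₂ (refl , ())) (inj₂ (refl , _))

digit : Bool → Fin 2
digit false = fzero
digit true  = fsuc fzero

digit-bit₁ : ∀ {q} (d : Fin q) (c b : Fin 2) → digit (bit₁ (toℕ (combine₃ d c b))) ≡ c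
digit-bit₁ d c b = trans (cong (λ x → digit (bit₁ x)) (toℕ-combine d (combine c b)))
                         (trans (cong digit (bit₁-4*+ (toℕ d) _)) (small c b))
  where
  small : ∀ (c b : Fin 2) → digit (bit₁ (toℕ (combine c b))) ≡ c
  small fzero        fzero        = refl
  small fzero        (fsuc fzero) = refl
  small (fsuc fzero) fzero        = refl
  small (fsuc fzero) (fsuc fzero) = refl

side : ∀ {A : Set} → Bool → A → A ⊎ A
side false = inj₁
side true  = inj₂

side-injective : ∀ {A : Set} {s s′} {x x′ : A} → side s x ≡ side s′ x′ → s ≡ s′ × x ≡ x′
side-injective {s = false} {false} refl = refl , refl
side-injective {s = true}  {true}  refl = refl , refl

module _ {m q : ℕ} where

  quarterIndex : Fin m → Fin (q * 4) → Fin (m * q * 2)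
  quarterIndex i g = let (d , _ , b) = remQuot₃ {q} {2} {2} g in combine (combine i d) b

  quarterBlock : Fin m → Fin (q * 4) → Fin (m * q * 2) ⊎ Fin (m * q * 2)
  quarterBlock i g = side (bit₁ (toℕ g)) (quarterIndex i g)

  quarterBlock-combine₃ : ∀ i d c b →
    quarterBlock i (combine₃ d c b) ≡ side (bit₁ (toℕ (combine₃ d c b))) (combine (combine i d) b)
  quarterBlock-combine₃ i d c b =
    cong (λ (x : Fin q × Fin 2 × Fin 2) → side (bit₁ (toℕ (combine₃ d c b))) (combine (combine i (proj₁ x)) (proj₂ (proj₂ x))))
         (remQuot₃-combine₃ d c b)

  quarterBlock-injective : ∀ {i g i′ g′} → quarterBlock i g ≡ quarterBlock i′ g′ → i ≡ i′ × g ≡ g′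
  quarterBlock-injective {i} {g} {i′} {g′} =
    combine₃-elim (λ g → quarterBlock i g ≡ quarterBlock i′ g′ → i ≡ i′ × g ≡ g′) (λ d c b →
      combine₃-elim (λ g′ → quarterBlock i (combine₃ d c b) ≡ quarterBlock i′ g′ → i ≡ i′ × combine₃ d c b ≡ g′)
        (λ d′ c′ b′ → on-digits d c b d′ c′ b′) g′) g
    where
    on-digits : ∀ d c b d′ c′ b′ → quarterBlock i (combine₃ d c b) ≡ quarterBlock i′ (combine₃ d′ c′ b′) →
                i ≡ i′ × combine₃ d c b ≡ combine₃ d′ c′ b′
    on-digits d c b d′ c′ b′ e
      with side-injective (trans (sym (quarterBlock-combine₃ i d c b)) (trans e (quarterBlock-combine₃ i′ d′ c′ b′)))
    ... | bit≡ , x≡ with combine-injective (combine i d) b (combine i′ d′) b′ x≡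
    ...   | i-d≡ , refl with combine-injective i d i′ d′ i-d≡
    ...     | refl , refl =
      refl , cong (λ c → combine₃ d c b) (trans (sym (digit-bit₁ d c b)) (trans (cong digit bit≡) (digit-bit₁ d c′ b)))

θ-quarters : ∀ {m q} t → 1 ≤ m → 1 ≤ q → θ-is (mCpKn m (q * 4) (3 + (t + t))) 0
θ-quarters {suc m} {suc q} t _ _ =
  θ-triples {suc m} {suc q * 4} t ≤-refl (n≤1+n K) 3≤p order β (quarterBlock-injective {suc m} {suc q}) _ alternating
    (fzero , corner , subst (λ c → suc (triple c (fsuc (fsuc fzero))) ≡ B + B + B + 0)
                             (sym (quarterBlock-combine₃ {suc m} {suc q} fzero fzero (fsuc fzero) fzero))
                             (top-inj₂ refl (combine (combine {suc m} {suc q} fzero fzero) fzero) refl))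
    (magic-label≥order {suc m} {suc q * 4} (s≤s z≤n) 3≤p (s≤s z≤n))
  where
  K = suc m * suc q * 2
  open Triples K K 0
  β = quarterBlock {suc m} {suc q}
  3≤p : 3 ≤ suc q * 4
  3≤p = s≤s (s≤s (s≤s z≤n))
  order : suc m * (suc q * 4) ≡ K + K
  order = sol (suc m) (suc q)
    where
    sol : ∀ m q → m * (q * 4) ≡ m * q * 2 + m * q * 2
    sol = solve-∀
  corner : Fin (suc q * 4)
  corner = combine₃ {suc q} {2} {2} fzero (fsuc fzero) fzero
  colSum-side : ∀ s x → colSum (side s x) ≡ colBase + (if s then suc K else K + 0)
  colSum-side false x = colSum-inj₁ x
  colSum-side true  x = colSum-inj₂ x
  alternating : ∀ i g → colSum (β i (next g)) + colSum (β i (prev g)) ≡ colBase + suc K + (colBase + (K + 0))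
  alternating i g = trans (cong₂ _+_ (colSum-side (bit₁ (toℕ (next g))) (quarterIndex {suc m} {suc q} i (next g)))
                                     (colSum-side (bit₁ (toℕ (prev g))) (quarterIndex {suc m} {suc q} i (prev g))))
                          (opposite-sides (bit₁-Succ {q} (Succ-next g) (Succ-prev g)))
    where
    opposite-sides : ∀ {s s′} → s ≡ not s′ →
      colBase + (if s then suc K else K + 0) + (colBase + (if s′ then suc K else K + 0)) ≡ colBase + suc K + (colBase + (K + 0))
    opposite-sides {s′ = true}  refl = +-comm (colBase + (K + 0)) (colBase + suc K)
    opposite-sides {s′ = false} refl = refl

*2≡+ : ∀ q → q * 2 ≡ q + q
*2≡+ q = trans (*-comm q 2) (cong (q +_) (+-identityʳ q))

2∣⊎odd : ∀ x → 2 ∣ x ⊎ ∃ λ q → x ≡ suc (q + q)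
2∣⊎odd zero = inj₁ (divides 0 refl)
2∣⊎odd (suc x) with 2∣⊎odd x
... | inj₁ (divides q x≡) = inj₂ (q , cong suc (trans x≡ (*2≡+ q)))
... | inj₂ (q , x≡)       = inj₁ (divides (suc q) (trans (cong suc x≡) (trans (cong suc (sym (+-suc q q))) (sym (*2≡+ (suc q))))))

even-form : ∀ {n} → 1 < n → 2 ∣ n → ∃ λ t → 1 ≤ t × n ≡ t + t
even-form 1<n (divides zero    refl) = contradiction 1<n λ ()
even-form _   (divides (suc t) n≡)   = suc t , s≤s z≤n , trans n≡ (*2≡+ (suc t))

odd-form : ∀ {n} → 1 < n → ¬ 2 ∣ n → ∃ λ t → n ≡ 3 + (t + t)
odd-form {n} 1<n 2∤n with 2∣⊎odd n
... | inj₁ 2∣n              = contradiction 2∣n 2∤n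
... | inj₂ (zero  , refl)   = contradiction 1<n λ { (s≤s ()) }
... | inj₂ (suc t , n≡)     = t , trans n≡ (cong (suc ∘ suc) (+-suc t t))

θ-odd-n : ∀ {m p n k} → 1 < n → ¬ 2 ∣ n → (∀ t → θ-is (mCpKn m p (3 + (t + t))) k) → θ-is (mCpKn m p n) k
θ-odd-n {m} {p} {k = k} 1<n 2∤n θ-t with odd-form 1<n 2∤n
... | t , n≡ = subst (λ n → θ-is (mCpKn m p n) k) (sym n≡) (θ-t t)

θ-2∣n : ∀ {m p n} → 1 ≤ m → 3 ≤ p → 1 < n → 2 ∣ n → θ-is (mCpKn m p n) 0
θ-2∣n {m} {p} 1≤m 3≤p 1<n 2∣n with even-form 1<n 2∣n
... | t , 1≤t , n≡ = subst (λ n → θ-is (mCpKn m p n) 0) (sym n≡) (θ-even-n 1≤m 3≤p 1≤t)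

mnp≡mpn : ∀ m n p → m * n * p ≡ m * p * n
mnp≡mpn m n p = trans (*-assoc m n p) (trans (cong (m *_) (*-comm n p)) (sym (*-assoc m p n)))

θ-2∤mnp : ∀ {m p n} → 1 ≤ m → 3 ≤ p → 1 < n → ¬ 2 ∣ m * n * p → θ-is (mCpKn m p n) 0
θ-2∤mnp {m} {p} {n} 1≤m 3≤p 1<n 2∤mnp with 2∣⊎odd (m * p)
... | inj₁ 2∣mp        = contradiction (subst (2 ∣_) (sym (mnp≡mpn m n p)) (∣m⇒∣m*n n 2∣mp)) 2∤mnp
... | inj₂ (H , mp≡)   = θ-odd-n {m} {p} 1<n (λ 2∣n → 2∤mnp (∣m⇒∣m*n p (∣n⇒∣m*n m 2∣n)))
                           λ t → θ-odd-mp {m} {p} {H} t 1≤m 3≤p mp≡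

θ-4∣p : ∀ {m p n} → 1 ≤ m → 3 ≤ p → 1 < n → ¬ 2 ∣ n → 4 ∣ p → θ-is (mCpKn m p n) 0
θ-4∣p {m} {n = n} 1≤m 3≤p 1<n 2∤n (divides zero    refl) = contradiction 3≤p λ ()
θ-4∣p {m} {n = n} 1≤m 3≤p 1<n 2∤n (divides (suc q) refl) =
  θ-odd-n {m} 1<n 2∤n λ t → θ-quarters {m} {suc q} t 1≤m (s≤s z≤n)

θ-otherwise : ∀ {m p n} → 1 ≤ m → 3 ≤ p → 1 < n → ¬ 2 ∣ n → 2 ∣ m * n * p → ¬ 4 ∣ p → θ-is (mCpKn m p n) 1
θ-otherwise {m} {p} {n} 1≤m 3≤p 1<n 2∤n 2∣mnp 4∤p
  with euclidsLemma (m * p) n prime[2] (subst (2 ∣_) (mnp≡mpn m n p) 2∣mnp)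
... | inj₂ 2∣n = contradiction 2∣n 2∤n
... | inj₁ 2∣mp with even-form (≤-trans (s≤s (s≤s z≤n)) (*-mono-≤ 1≤m 3≤p)) 2∣mp | oddClass 3≤p 4∤p
...   | suc K , _ , mp≡ | odd = θ-odd-n {m} {p} 1<n 2∤n λ t → θ-even-mp {m} {p} {K} t 1≤m 3≤p mp≡ odd

theorem14 : (m n p : ℕ) → 1 ≤ m → 1 < n → 3 ≤ p →
    let cond = (2 ∣ n) ⊎ (¬ 2 ∣ (m * n * p)) ⊎ ((¬ 2 ∣ n) × (4 ∣ p)) in
    (cond → θ-is (mCpKn m p n) 0) × (¬ cond → θ-is (mCpKn m p n) 1)
theorem14 m n p 1≤m 1<n 3≤p = θ₀ , θ₁
  where
  θ₀ : (2 ∣ n) ⊎ (¬ 2 ∣ (m * n * p)) ⊎ ((¬ 2 ∣ n) × (4 ∣ p)) → θ-is (mCpKn m p n) 0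
  θ₀ (inj₁ 2∣n)                 = θ-2∣n 1≤m 3≤p 1<n 2∣n
  θ₀ (inj₂ (inj₁ 2∤mnp))        = θ-2∤mnp 1≤m 3≤p 1<n 2∤mnp
  θ₀ (inj₂ (inj₂ (2∤n , 4∣p))) = θ-4∣p 1≤m 3≤p 1<n 2∤n 4∣p
  θ₁ : ¬ ((2 ∣ n) ⊎ (¬ 2 ∣ (m * n * p)) ⊎ ((¬ 2 ∣ n) × (4 ∣ p))) → θ-is (mCpKn m p n) 1
  θ₁ ¬cond = θ-otherwise 1≤m 3≤p 1<n 2∤n
               (decidable-stable (2 ∣? (m * n * p)) (¬cond ∘ inj₂ ∘ inj₁))
               (λ 4∣p → ¬cond (inj₂ (inj₂ (2∤n , 4∣p))))
    where
    2∤n : ¬ 2 ∣ n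
    2∤n = ¬cond ∘ inj₁
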